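{- Let $\operatorname{X}$ be a simple and nearly well behaved color change rule. If $B$ is an $\operatorname{X}$ forcing set of a graph $G$, then there exists a set of $\operatorname{X}$ forces of $B$ which is uniformly as fast as possible.
   Context: All graphs are simple, finite and undirected. A color change rule $\operatorname{X}$ specifies, for a graph $G$ and a current set of blue vertices (others white), which forces $v\rightarrow w$ ($w$ white) are valid; performing one turns $w$ blue. From an initial blue set $B$, applying valid forces until none is possible gives an $\operatorname{X}$ final coloring; $B$ is an $\operatorname{X}$ forcing set if $V(G)$ is an $\operatorname{X}$ final coloring of $B$. The set of forces in a chronological list of forces so performed is a set of $\operatorname{X}$ forces of $B$. For such $\mathcal{F}$: $\mathcal{F}^{(0)}=B$; for $t>0$, with $\bigcup_{i<t}\mathcal{F}^{(i)}$ blue, $\mathcal{F}^{(t)}$ is the set of white $w$ with some blue $b$ such that $(b\rightarrow w)\in\mathcal{F}$ is valid; $\mathcal{F}^{[t]}=\bigcup_{i\le t}\mathcal{F}^{(i)}$; $U_{\mathcal F}^{(0)}=\emptyset$ and $U_{\mathcal F}^{(t)}$ is the set of vertices performing forces in time step $t$. $\operatorname{pt}_{\operatorname{X}}(G;\mathcal{F})$ is the least $q$ with $\mathcal{F}^{[q]}=V(G)$ ($\infty$ if none). $\operatorname{X}$ is nearly well behaved if for every graph $G$, every $\operatorname{X}$ forcing set $B$ and every set of forces $\mathcal{F}$ of $B$ with finite propagation time: (1) every superset of an $\operatorname{X}$ forcing set of $G$ is an $\operatorname{X}$ forcing set of $G$, and (2) $|U_{\mathcal F}^{(i)}|\le|\mathcal{F}^{(i)}|$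 for all $0\le i\le\operatorname{pt}_{\operatorname{X}}(G;\mathcal{F})$. $\operatorname{X}$ is simple if whenever $u\rightarrow v$ and $x\rightarrow y$ are valid given a blue set $B$ (with $v\ne y$), they can be performed simultaneously. A set of forces $\mathcal{F}_*$ of $B$ is uniformly as fast as possible if for every vertex $v\in V(G)\setminus B$ and every set of forces $\mathcal{F}$ of $B$, $v\in\mathcal{F}_*^{(i)}\cap\mathcal{F}^{(j)}$ implies $i\le j$. -}

module Defs where

open import Data.Bool using (Bool; true; false; _∧_; _∨_; not)
open import Data.Nat using (ℕ; zero; suc; _≤_; _<_)
open import Data.Fin using (Fin; zero; suc)
open import Data.Fin.Subset using (Subset; _∈_; _∉_; _∪_; ⁅_⁆; ⊤; ⊥; _⊆_; ∣_∣)
open import Data.Vec using (Vec; lookup; tabulate)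
open import Data.List using (List; []; _∷_)
open import Data.List.Membership.Propositional using () renaming (_∈_ to _∈ₗ_)
open import Data.Product using (_×_; _,_; Σ; ∃; ∃-syntax)
open import Data.Unit using () renaming (⊤ to Unit)
open import Relation.Binary.PropositionalEquality using (_≡_; _≢_)
open import Relation.Nullary using (¬_)

record Graph (n : ℕ) : Set where
  field
    adj     : Fin n → Fin n → Bool
    adj-sym : ∀ i j → adj i j ≡ adj j i
    irrefl  : ∀ i → adj i i ≡ false

-- A colour change rule: given a graph and the current blue set S,
-- X G S v w ≡ true  says that the force v → w is allowed by the rule.
-- (A force is *valid* when moreover w is white, see ValidForce.)

Rule : Set
Rule = ∀ {n} → Graph n → Subset n → Fin n → Fin n → Bool

ValidForce : Rule → ∀ {n} → Graph n → Subset n → Fin n → Fin n → Set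
ValidForce X G S v w = (w ∉ S) × (X G S v w ≡ true)

final : ∀ {n} → Subset n → List (Fin n × Fin n) → Subset n
final S []             = S
final S ((v , w) ∷ fs) = final (S ∪ ⁅ w ⁆) fs

Chronological : Rule → ∀ {n} → Graph n → Subset n → List (Fin n × Fin n) → Set
Chronological X G S []             = Unit
Chronological X G S ((v , w) ∷ fs) =
  ValidForce X G S v w × Chronological X G (S ∪ ⁅ w ⁆) fs

Terminal : Rule → ∀ {n} → Graph n → Subset n → Set
Terminal X {n} G S = ∀ (v w : Fin n) → ¬ ValidForce X G S v w

CompleteList : Rule → ∀ {n} → Graph n → Subset n → List (Fin n × Fin n) → Set
CompleteList X G B L = Chronological X G B L × Terminal X G (final B L)

IsForcingSet : Rule → ∀ {n} → Graph n → Subset n → Set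
IsForcingSet X G B = ∃[ L ] (CompleteList X G B L × final B L ≡ ⊤)

ForceSet : ℕ → Set
ForceSet n = Fin n → Fin n → Bool

IsForceSet : Rule → ∀ {n} → Graph n → Subset n → ForceSet n → Set
IsForceSet X {n} G B F =
  ∃[ L ] (CompleteList X G B L ×
          (∀ (b w : Fin n) → (F b w ≡ true → (b , w) ∈ₗ L) × ((b , w) ∈ₗ L → F b w ≡ true)))

anyFin : ∀ {n} → (Fin n → Bool) → Bool
anyFin {zero}  f = false
anyFin {suc n} f = f zero ∨ anyFin (λ i → f (suc i))

module TimeSteps (X : Rule) {n : ℕ} (G : Graph n) (B : Subset n) (F : ForceSet n) where

  active : Subset n → Fin n → Fin n → Bool
  active S b w = lookup S b ∧ not (lookup S w) ∧ F b w ∧ X G S b w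

  newly : Subset n → Subset n
  newly S = tabulate (λ w → anyFin (λ b → active S b w))

  forcers : Subset n → Subset n
  forcers S = tabulate (λ b → anyFin (λ w → active S b w))

  cum : ℕ → Subset n
  step : ℕ → Subset n
  cum zero    = B
  cum (suc t) = cum t ∪ step (suc t)
  step zero    = B
  step (suc t) = newly (cum t)

  U : ℕ → Subset n
  U zero    = ⊥
  U (suc t) = forcers (cum t)

  IsPt : ℕ → Set
  IsPt q = (cum q ≡ ⊤) × (∀ q' → q' < q → cum q' ≢ ⊤)

  FinitePt : Set
  FinitePt = ∃[ q ] (cum q ≡ ⊤)

NearlyWellBehaved : Rule → Set
NearlyWellBehaved X =
  ∀ {n} (G : Graph n) (B : Subset n) (F : ForceSet n) →
  IsForcingSet X G B → IsForceSet X G B F → TimeSteps.FinitePt X G B F →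
  (∀ (S S' : Subset n) → IsForcingSet X G S → S ⊆ S' → IsForcingSet X G S')
  × (∀ q → TimeSteps.IsPt X G B F q → ∀ i → i ≤ q →
       ∣ TimeSteps.U X G B F i ∣ ≤ ∣ TimeSteps.step X G B F i ∣)

-- two valid forces with distinct targets can be performed simultaneously:
-- performing one of them leaves the other valid
Simple : Rule → Set
Simple X = ∀ {n} (G : Graph n) (S : Subset n) (u v x y : Fin n) →
  ValidForce X G S u v → ValidForce X G S x y → v ≢ y →
  ValidForce X G (S ∪ ⁅ v ⁆) x y

UniformlyFast : Rule → ∀ {n} → Graph n → Subset n → ForceSet n → Set
UniformlyFast X {n} G B F* =
  ∀ (v : Fin n) → v ∉ B → ∀ (F : ForceSet n) → IsForceSet X G B F →
  ∀ i j → v ∈ TimeSteps.step X G B F* i → v ∈ TimeSteps.step X G B F j → i ≤ j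

-- For a simple rule a valid force stays valid until its target turns blue, which makes forcing
-- confluent: if T and T′ are both reachable from S by valid forces, then T ∪ T′ is reachable from T.
-- Let the greedy schedule perform, at each time step, every valid force from a blue vertex, and let
-- G_t be its blue set after t steps. For any set of forces F, induction on t gives F^[t] ⊆ G_t:
-- both sets are reachable from B, so G_t is reachable from F^[t]; hence a force that F performs at
-- time t + 1 is still valid at G_t (or its target is already blue), so the greedy schedule has
-- coloured that vertex by time t + 1 as well. The greedy schedule is realised by a set of forces F*
-- that picks one forcer for each vertex it colours; it is stuck after n + 1 steps, and the remaining
-- valid forces appended to complete the list do not change the time steps of F*.

module Submission where

open import Defs
open import Data.Nat using (ℕ)
open import Data.Fin.Subset using (Subset)
open import Data.Product using (_×_; ∃-syntax)

open import Algebra.Bundles using (CommutativeMonoid)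
open import Data.Bool using (Bool; true; false; if_then_else_)
open import Data.Bool.Properties using () renaming (_≟_ to _≟ᵇ_)
open import Data.Empty using (⊥-elim)
open import Data.Fin using (Fin; zero; suc; _≟_)
open import Data.Fin.Properties using (any?)
open import Data.Fin.Subset using (_∈_; _∉_; _⊆_; _∪_; ⁅_⁆; ∣_∣; Empty)
open import Data.Fin.Subset.Properties
  using (_∈?_; ⊆-antisym; p⊆p∪q; q⊆p∪q; x∈p∪q⁺; x∈p∪q⁻; x∈⁅x⁆; x∈⁅y⁆⇒x≡y; ∪-comm; ∪-identityʳ;
         ∪-commutativeMonoid; ∣p∣≤n; p⊂q⇒∣p∣<∣q∣; Empty-unique; nonempty?)
open import Data.List using (List; []; _∷_; _++_; allFin)
open import Data.List.Membership.Propositional using () renaming (_∈_ to _∈ₗ_)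
open import Data.List.Membership.Propositional.Properties using (∈-allFin; ∈-++⁺ˡ; ∈-++⁺ʳ)
open import Data.List.Relation.Unary.Any using (here; there; tail)
open import Data.Maybe using (Maybe; just; nothing; is-just)
import Data.Maybe as Maybe
open import Data.Maybe.Properties using (just-injective)
open import Data.Nat using (zero; suc; _≤_; _<_; z≤n; s≤s; _+_; _≤′_; ≤′-refl; ≤′-step; _≤?_)
open import Data.Nat.Properties
  using (≤-trans; <-irrefl; ≤-<-trans; <-≤-trans; ≤-pred; ≰⇒>; ≤⇒≤′; m≤m+n; +-suc; +-monoʳ-≤;
         m≤n⇒m<n∨m≡n)
open import Data.Product using (∃; ∃₂; _,_; proj₁; proj₂)
open import Data.Product.Properties using (≡-dec)
open import Data.Sum using (_⊎_; inj₁; inj₂; [_,_]′; map₂)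
open import Data.Unit using (tt)
open import Data.Vec using (lookup; tabulate)
open import Data.Vec.Properties using (lookup∘tabulate; tabulate-cong; []=⇒lookup; lookup⇒[]=)
open import Function using (_∘_; id; case_of_)
open import Relation.Nullary using (Dec; yes; no; does; ¬?)
open import Relation.Nullary.Decidable using (_×-dec_; dec-true)
open import Relation.Binary.PropositionalEquality

anyFin⁺ : ∀ {m} (f : Fin m → Bool) {i} → f i ≡ true → anyFin f ≡ true
anyFin⁺ f {zero}  fi rewrite fi = refl
anyFin⁺ f {suc i} fi with f zero
... | true  = refl
... | false = anyFin⁺ (f ∘ suc) fi

firstFin : ∀ {m} → (Fin m → Bool) → Maybe (Fin m)
firstFin {zero}  f = nothing
firstFin {suc m} f = if f zero then just zero else Maybe.map suc (firstFin (f ∘ suc))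

firstFin-just : ∀ {m} (f : Fin m → Bool) {i} → firstFin f ≡ just i → f i ≡ true
firstFin-just {suc m} f e with f zero in fz
firstFin-just {suc m} f refl | true = fz
... | false with firstFin (f ∘ suc) in e′
firstFin-just {suc m} f refl | false | just j = firstFin-just (f ∘ suc) e′

is-just-firstFin : ∀ {m} (f : Fin m → Bool) → is-just (firstFin f) ≡ anyFin f
is-just-firstFin {zero}  f = refl
is-just-firstFin {suc m} f with f zero
... | true  = refl
... | false with firstFin (f ∘ suc) | is-just-firstFin (f ∘ suc)
...   | just _  | ih = ih
...   | nothing | ih = ih

∈-tabulate⁺ : ∀ {m} {f : Fin m → Bool} {x} → f x ≡ true → x ∈ tabulate f
∈-tabulate⁺ {f = f} {x} fx = lookup⇒[]= x (tabulate f) (trans (lookup∘tabulate f x) fx)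

∈-tabulate⁻ : ∀ {m} {f : Fin m → Bool} {x} → x ∈ tabulate f → f x ≡ true
∈-tabulate⁻ {f = f} {x} x∈ = trans (sym (lookup∘tabulate f x)) ([]=⇒lookup x∈)

∉⇒lookup≡false : ∀ {m} {p : Subset m} {x} → x ∉ p → lookup p x ≡ false
∉⇒lookup≡false {p = p} {x} x∉p with lookup p x in e
... | true  = ⊥-elim (x∉p (lookup⇒[]= x p e))
... | false = refl

x∈p∪⁅x⁆ : ∀ {m} (p : Subset m) x → x ∈ p ∪ ⁅ x ⁆
x∈p∪⁅x⁆ p x = x∈p∪q⁺ (inj₂ (x∈⁅x⁆ x))

x∈p⇒⁅x⁆⊆p : ∀ {m} {p : Subset m} {x} → x ∈ p → ⁅ x ⁆ ⊆ p
x∈p⇒⁅x⁆⊆p {p = p} {x} x∈p y∈ = subst (_∈ p) (sym (x∈⁅y⁆⇒x≡y x y∈)) x∈p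

q⊆p⇒p∪q≡p : ∀ {m} {p q : Subset m} → q ⊆ p → p ∪ q ≡ p
q⊆p⇒p∪q≡p {p = p} {q} q⊆p = ⊆-antisym (λ x∈ → [ id , q⊆p ]′ (x∈p∪q⁻ p q x∈)) (p⊆p∪q q)

p⊆q⇒p∪q≡q : ∀ {m} {p q : Subset m} → p ⊆ q → p ∪ q ≡ q
p⊆q⇒p∪q≡q {p = p} {q} p⊆q = trans (∪-comm p q) (q⊆p⇒p∪q≡p p⊆q)

x∉p∪⁅y⁆ : ∀ {m} {p : Subset m} {x y} → x ∉ p → x ≢ y → x ∉ p ∪ ⁅ y ⁆
x∉p∪⁅y⁆ {p = p} {y = y} x∉p x≢y x∈ = [ x∉p , x≢y ∘ x∈⁅y⁆⇒x≡y y ]′ (x∈p∪q⁻ p _ x∈)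

∣p∣<∣p∪⁅x⁆∣ : ∀ {m} {p : Subset m} {x} → x ∉ p → ∣ p ∣ < ∣ p ∪ ⁅ x ⁆ ∣
∣p∣<∣p∪⁅x⁆∣ {p = p} {x} x∉p = p⊂q⇒∣p∣<∣q∣ (p⊆p∪q _ , x , x∈p∪⁅x⁆ p x , x∉p)

module Forcing (X : Rule) {n : ℕ} (G : Graph n) where

  open import Algebra.Properties.CommutativeSemigroup
    (CommutativeMonoid.commutativeSemigroup (∪-commutativeMonoid n))
    using (xy∙z≈xz∙y; x∙yz≈xz∙y)

  open import Data.List.Membership.DecPropositional (≡-dec (_≟_ {n}) (_≟_ {n}))
    using () renaming (_∈?_ to _∈ₗ?_)

  private variable
    S T T′ U : Subset n
    b w x : Fin n
    choose : Fin n → Maybe (Fin n)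

  Valid : Subset n → Fin n → Fin n → Set
  Valid = ValidForce X G

  infix 4 _⇝_
  data _⇝_ : Subset n → Subset n → Set where
    done  : S ⇝ S
    force : Valid S b w → S ∪ ⁅ w ⁆ ⇝ T → S ⇝ T

  ⇝-⊆ : S ⇝ T → S ⊆ T
  ⇝-⊆ done        = id
  ⇝-⊆ (force _ r) = ⇝-⊆ r ∘ p⊆p∪q _

  final-⊇ : ∀ (S : Subset n) L → S ⊆ final S L
  final-⊇ S []            = id
  final-⊇ S ((_ , w) ∷ L) = final-⊇ (S ∪ ⁅ w ⁆) L ∘ p⊆p∪q _

  final-∋-target : ∀ (S : Subset n) L → (b , w) ∈ₗ L → w ∈ final S L
  final-∋-target S ((_ , w) ∷ L) (here refl) = final-⊇ (S ∪ ⁅ w ⁆) L (x∈p∪⁅x⁆ S w)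
  final-∋-target S ((_ , w) ∷ L) (there m)   = final-∋-target (S ∪ ⁅ w ⁆) L m

  final-++ : ∀ (S : Subset n) L L′ → final S (L ++ L′) ≡ final (final S L) L′
  final-++ S []            L′ = refl
  final-++ S ((_ , w) ∷ L) L′ = final-++ (S ∪ ⁅ w ⁆) L L′

  chronological-++ : ∀ (S : Subset n) L L′ → Chronological X G S L →
                     Chronological X G (final S L) L′ → Chronological X G S (L ++ L′)
  chronological-++ S []            L′ _       c′ = c′
  chronological-++ S ((_ , w) ∷ L) L′ (v , c) c′ = v , chronological-++ (S ∪ ⁅ w ⁆) L L′ c c′

  complete-++ : ∀ L L′ → Chronological X G S L →
                CompleteList X G (final S L) L′ → CompleteList X G S (L ++ L′)
  complete-++ {S} L L′ c (c′ , t′) =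
    chronological-++ S L L′ c c′ , subst (Terminal X G) (sym (final-++ S L L′)) t′

  chronological⇒⇝ : ∀ (S : Subset n) L → Chronological X G S L → S ⇝ final S L
  chronological⇒⇝ S []            _       = done
  chronological⇒⇝ S ((_ , w) ∷ L) (v , c) = force v (chronological⇒⇝ (S ∪ ⁅ w ⁆) L c)

  valid? : ∀ S → Dec (∃₂ λ b w → Valid S b w)
  valid? S = any? λ b → any? λ w → ¬? (w ∈? S) ×-dec (X G S b w ≟ᵇ true)

  -- Each force adds a vertex to S, so fuel ≥ n ∸ ∣ S ∣ forces are enough to exhaust the valid ones.
  completion : ∀ fuel S → n ≤ fuel + ∣ S ∣ → ∃[ L ] CompleteList X G S L
  completion fuel S n≤ with valid? S
  ... | no none = [] , tt , λ b w v → none (b , w , v)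
  completion zero S n≤ | yes (_ , w , v) =
    ⊥-elim (<-irrefl refl (<-≤-trans (≤-<-trans n≤ (∣p∣<∣p∪⁅x⁆∣ (proj₁ v))) (∣p∣≤n (S ∪ ⁅ w ⁆))))
  completion (suc fuel) S n≤ | yes (b , w , v) =
    let L , c , t = completion fuel (S ∪ ⁅ w ⁆) n≤′ in (b , w) ∷ L , (v , c) , t
    where n≤′ : n ≤ fuel + ∣ S ∪ ⁅ w ⁆ ∣
          n≤′ = ≤-trans n≤ (subst (_≤ fuel + ∣ S ∪ ⁅ w ⁆ ∣) (+-suc fuel ∣ S ∣)
                                  (+-monoʳ-≤ fuel (∣p∣<∣p∪⁅x⁆∣ (proj₁ v))))

  round : (Fin n → Maybe (Fin n)) → Subset n → List (Fin n) → List (Fin n × Fin n)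
  round choose S []       = []
  round choose S (w ∷ ws) with choose w | w ∈? S
  ... | just b | no _ = (b , w) ∷ round choose (S ∪ ⁅ w ⁆) ws
  ... | _      | _    = round choose S ws

  round-∋ : ∀ choose S ws → choose w ≡ just b → w ∉ S → w ∈ₗ ws → (b , w) ∈ₗ round choose S ws
  round-∋ {w} choose S (w′ ∷ ws) e w∉S m with choose w′ in e′ | w′ ∈? S | w′ ≟ w
  ... | just b′ | no _     | yes refl =
    subst (λ b → (b , w) ∈ₗ _) (just-injective (trans (sym e′) e)) (here refl)
  ... | just _  | no _     | no w′≢w  =
    there (round-∋ choose (S ∪ ⁅ w′ ⁆) ws e (x∉p∪⁅y⁆ w∉S (w′≢w ∘ sym)) (tail (w′≢w ∘ sym) m))
  ... | just _  | yes w∈S  | yes refl = ⊥-elim (w∉S w∈S)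
  ... | just _  | yes _    | no w′≢w  = round-∋ choose S ws e w∉S (tail (w′≢w ∘ sym) m)
  ... | nothing | _        | yes refl with () ← trans (sym e′) e
  ... | nothing | _        | no w′≢w  = round-∋ choose S ws e w∉S (tail (w′≢w ∘ sym) m)

  final-round⁻ : ∀ choose S ws → x ∈ final S (round choose S ws) → x ∈ S ⊎ is-just (choose x) ≡ true
  final-round⁻ choose S []       x∈ = inj₁ x∈
  final-round⁻ choose S (w ∷ ws) x∈ with choose w in e | w ∈? S
  ... | just b  | no _ with final-round⁻ choose (S ∪ ⁅ w ⁆) ws x∈
  ...   | inj₂ chosen = inj₂ chosen
  ...   | inj₁ x∈S∪w with x∈p∪q⁻ S ⁅ w ⁆ x∈S∪w
  ...     | inj₁ x∈S = inj₁ x∈S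
  ...     | inj₂ x∈w rewrite x∈⁅y⁆⇒x≡y w x∈w = inj₂ (cong is-just e)
  final-round⁻ choose S (w ∷ ws) x∈ | just _  | yes _ = final-round⁻ choose S ws x∈
  final-round⁻ choose S (w ∷ ws) x∈ | nothing | _     = final-round⁻ choose S ws x∈

  final-round⁺ : ∀ choose S ws → x ∈ₗ ws → is-just (choose x) ≡ true → x ∈ final S (round choose S ws)
  final-round⁺ {x} choose S ws m chosen with choose x in e | x ∈? S
  ... | just _ | yes x∈S = final-⊇ S (round choose S ws) x∈S
  ... | just _ | no x∉S  = final-∋-target S (round choose S ws) (round-∋ choose S ws e x∉S m)

  final-round : ∀ choose S → final S (round choose S (allFin n)) ≡ S ∪ tabulate (is-just ∘ choose)
  final-round choose S = ⊆-antisym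
    (λ x∈ → x∈p∪q⁺ (map₂ ∈-tabulate⁺ (final-round⁻ choose S (allFin n) x∈)))
    (λ x∈ → [ final-⊇ S (round choose S (allFin n))
            , final-round⁺ choose S (allFin n) (∈-allFin _) ∘ ∈-tabulate⁻
            ]′ (x∈p∪q⁻ S _ x∈))

  Chooses : (Fin n → Maybe (Fin n)) → Subset n → Set
  Chooses choose S = ∀ {b w} → choose w ≡ just b → w ∉ S → Valid S b w

  module Steps (B : Subset n) (F : ForceSet n) where

    open TimeSteps X G B F public

    active⁻ : ∀ {S b w} → active S b w ≡ true → b ∈ S × F b w ≡ true × Valid S b w
    active⁻ {S} {b} {w} a with lookup S b in eb | lookup S w in ew | F b w | X G S b w
    ... | true | false | true | true =
      lookup⇒[]= b S eb , refl , (λ w∈S → case trans (sym ([]=⇒lookup w∈S)) ew of λ ()) , refl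

    active⁺ : ∀ {S b w} → b ∈ S → F b w ≡ true → Valid S b w → active S b w ≡ true
    active⁺ {S} {b} b∈S Fbw (w∉S , Xbw)
      rewrite []=⇒lookup b∈S | ∉⇒lookup≡false w∉S | Fbw | Xbw = refl

    forcer : Subset n → Fin n → Maybe (Fin n)
    forcer S w = firstFin (λ b → active S b w)

    forcer-chooses : Chooses (forcer S) S
    forcer-chooses e _ = proj₂ (proj₂ (active⁻ (firstFin-just _ e)))

    newly≡chosen : ∀ S → newly S ≡ tabulate (is-just ∘ forcer S)
    newly≡chosen S = sym (tabulate-cong λ w → is-just-firstFin (λ b → active S b w))

    step-round : Subset n → List (Fin n × Fin n)
    step-round S = round (forcer S) S (allFin n)

    final-step-round : ∀ S → final S (step-round S) ≡ S ∪ newly S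
    final-step-round S = trans (final-round (forcer S) S) (cong (S ∪_) (sym (newly≡chosen S)))

    newly-forced-in-step-round : ∀ {S w} → w ∈ newly S →
                                 ∃ λ b → (b , w) ∈ₗ step-round S × active S b w ≡ true
    newly-forced-in-step-round {S} {w} w∈
      with forcer S w in e | ∈-tabulate⁻ (subst (w ∈_) (newly≡chosen S) w∈)
    ... | just b | _ = b , round-∋ (forcer S) S (allFin n) e (proj₁ v) (∈-allFin w) , a
      where a = firstFin-just _ e
            v = proj₂ (proj₂ (active⁻ a))

    ∈-newly⁻ : ∀ {S w} → w ∈ newly S → ∃ λ b → b ∈ S × F b w ≡ true × Valid S b w
    ∈-newly⁻ {S} {w} w∈ with newly-forced-in-step-round {S} w∈
    ... | b , _ , a = b , active⁻ {S} {b} {w} a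

    ∈-newly⁺ : ∀ {S b w} → b ∈ S → F b w ≡ true → Valid S b w → w ∈ newly S
    ∈-newly⁺ {S} {_} {w} b∈S Fbw v = ∈-tabulate⁺ (anyFin⁺ (λ b → active S b w) (active⁺ b∈S Fbw v))

    newly-white : ∀ {S w} → w ∈ newly S → w ∉ S
    newly-white {S} w∈ = proj₁ (proj₂ (proj₂ (proj₂ (∈-newly⁻ {S} w∈))))

    rounds : ℕ → List (Fin n × Fin n)
    rounds zero    = []
    rounds (suc t) = rounds t ++ step-round (cum t)

    final-rounds : ∀ t → final B (rounds t) ≡ cum t
    final-rounds zero    = refl
    final-rounds (suc t) = begin
      final B (rounds t ++ step-round (cum t))
        ≡⟨ final-++ B (rounds t) _ ⟩
      final (final B (rounds t)) (step-round (cum t))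
        ≡⟨ cong (λ S → final S (step-round (cum t))) (final-rounds t) ⟩
      final (cum t) (step-round (cum t))
        ≡⟨ final-step-round (cum t) ⟩
      cum (suc t)
        ∎
      where open ≡-Reasoning

    step-round⊆rounds : ∀ {t k p} → t < k → p ∈ₗ step-round (cum t) → p ∈ₗ rounds k
    step-round⊆rounds {t} {suc k} t<k m with m≤n⇒m<n∨m≡n (≤-pred t<k)
    ... | inj₁ t<k′ = ∈-++⁺ˡ (step-round⊆rounds t<k′ m)
    ... | inj₂ refl = ∈-++⁺ʳ (rounds t) m

    step⊆cum : ∀ t → step t ⊆ cum t
    step⊆cum zero    = id
    step⊆cum (suc t) = q⊆p∪q (cum t) _

    cum-mono : ∀ {i j} → j ≤ i → cum j ⊆ cum i
    cum-mono = go ∘ ≤⇒≤′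
      where go : ∀ {i j} → j ≤′ i → cum j ⊆ cum i
            go ≤′-refl       = id
            go (≤′-step j≤i) = p⊆p∪q _ ∘ go j≤i

    idle-stays : ∀ t → Empty (newly (cum t)) → Empty (newly (cum (suc t)))
    idle-stays t idle = subst (Empty ∘ newly) (sym cum-stays) idle
      where cum-stays : cum (suc t) ≡ cum t
            cum-stays = trans (cong (cum t ∪_) (Empty-unique idle)) (∪-identityʳ (cum t))

    idle-or-grown : ∀ t → Empty (newly (cum t)) ⊎ t ≤ ∣ cum t ∣
    idle-or-grown zero = inj₂ z≤n
    idle-or-grown (suc t) with idle-or-grown t | nonempty? (newly (cum t))
    ... | inj₁ idle | _              = inj₁ (idle-stays t idle)
    ... | inj₂ _    | no idle        = inj₁ (idle-stays t idle)
    ... | inj₂ t≤   | yes (w , w∈) =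
      inj₂ (<-≤-trans (s≤s t≤) (p⊂q⇒∣p∣<∣q∣ (p⊆p∪q _ , w , q⊆p∪q (cum t) _ w∈ , newly-white w∈)))

    idle-after : ∀ t → n < t → Empty (newly (cum t))
    idle-after t n<t with idle-or-grown t
    ... | inj₁ idle = idle
    ... | inj₂ t≤   = ⊥-elim (<-irrefl refl (<-≤-trans n<t (≤-trans t≤ (∣p∣≤n (cum t)))))

  module _ (simple : Simple X) where

    valid-persists : Valid S b w → S ⇝ T → w ∉ T → Valid T b w
    valid-persists v done w∉T = v
    valid-persists {S} {w = w} v (force {w = w′} v′ r) w∉T =
      valid-persists (simple G S _ w′ _ w v′ v w′≢w) r w∉T
      where w′≢w : w′ ≢ w
            w′≢w refl = w∉T (⇝-⊆ r (x∈p∪⁅x⁆ S w))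

    ⇝-∪⁅⁆ : Valid S b w → S ⇝ T → S ∪ ⁅ w ⁆ ⇝ T ∪ ⁅ w ⁆
    ⇝-∪⁅⁆ v done = done
    ⇝-∪⁅⁆ {S} {w = w} {T} v (force {w = w′} v′ r) with w′ ≟ w
    ... | yes refl = subst (S ∪ ⁅ w ⁆ ⇝_) (sym (q⊆p⇒p∪q≡p (x∈p⇒⁅x⁆⊆p (⇝-⊆ r (x∈p∪⁅x⁆ S w))))) r
    ... | no w′≢w  = force (simple G S _ w _ w′ v v′ (w′≢w ∘ sym))
                           (subst (_⇝ T ∪ ⁅ w ⁆) (xy∙z≈xz∙y S ⁅ w′ ⁆ ⁅ w ⁆)
                                  (⇝-∪⁅⁆ (simple G S _ w′ _ w v′ v w′≢w) r))

    ⇝-confluent : S ⇝ T → S ⇝ T′ → T ⇝ T ∪ T′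
    ⇝-confluent done r′ = subst (_ ⇝_) (sym (p⊆q⇒p∪q≡q (⇝-⊆ r′))) r′
    ⇝-confluent {S} {T} {T′} (force {w = w} v r) r′ =
      subst (T ⇝_) T∪T′∪w≡T∪T′ (⇝-confluent r (⇝-∪⁅⁆ v r′))
      where T∪T′∪w≡T∪T′ : T ∪ (T′ ∪ ⁅ w ⁆) ≡ T ∪ T′
            T∪T′∪w≡T∪T′ = trans (x∙yz≈xz∙y T T′ ⁅ w ⁆)
                                (cong (_∪ T′) (q⊆p⇒p∪q≡p (x∈p⇒⁅x⁆⊆p (⇝-⊆ r (x∈p∪⁅x⁆ S w)))))

    ⇝-between : S ⇝ T → S ⇝ U → T ⊆ U → T ⇝ U
    ⇝-between r r′ T⊆U = subst (_ ⇝_) (p⊆q⇒p∪q≡q T⊆U) (⇝-confluent r r′)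

    chooses-∪⁅⁆ : Chooses choose S → choose w ≡ just b → w ∉ S → Chooses choose (S ∪ ⁅ w ⁆)
    chooses-∪⁅⁆ {S = S} {w} ch e w∉S e′ w′∉ =
      simple G S _ w _ _ (ch e w∉S) (ch e′ (w′∉ ∘ p⊆p∪q _)) λ { refl → w′∉ (x∈p∪⁅x⁆ S w) }

    round-chronological : ∀ choose S ws → Chooses choose S → Chronological X G S (round choose S ws)
    round-chronological choose S []       _  = tt
    round-chronological choose S (w ∷ ws) ch with choose w in e | w ∈? S
    ... | just b  | no w∉S =
      ch e w∉S , round-chronological choose (S ∪ ⁅ w ⁆) ws (chooses-∪⁅⁆ ch e w∉S)
    ... | just _  | yes _  = round-chronological choose S ws ch
    ... | nothing | _      = round-chronological choose S ws ch

    module _ (B : Subset n) (F : ForceSet n) where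
      open Steps B F

      rounds-chronological : ∀ t → Chronological X G B (rounds t)
      rounds-chronological zero    = tt
      rounds-chronological (suc t) = chronological-++ B (rounds t) _ (rounds-chronological t)
        (subst (λ S → Chronological X G S (step-round (cum t))) (sym (final-rounds t))
               (round-chronological (forcer (cum t)) (cum t) (allFin n) forcer-chooses))

      B⇝cum : ∀ t → B ⇝ cum t
      B⇝cum t = subst (B ⇝_) (final-rounds t) (chronological⇒⇝ B (rounds t) (rounds-chronological t))

    module GreedyForces (B : Subset n) where

      module Greedy = Steps B (λ _ _ → true)

      cum⊆greedy : ∀ F t → Steps.cum B F t ⊆ Greedy.cum t
      cum⊆greedy F zero = id
      cum⊆greedy F (suc t) {x} x∈ with x∈p∪q⁻ _ _ x∈
      ... | inj₁ x∈cum = p⊆p∪q _ (cum⊆greedy F t x∈cum)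
      ... | inj₂ x∈new with Steps.∈-newly⁻ B F x∈new | x ∈? Greedy.cum t
      ...   | _              | yes x∈G = p⊆p∪q _ x∈G
      ...   | b , b∈ , _ , v | no x∉G  =
        q⊆p∪q (Greedy.cum t) _ (Greedy.∈-newly⁺ (cum⊆greedy F t b∈) refl
          (valid-persists v (⇝-between (B⇝cum B F t) (B⇝cum B _ t) (cum⊆greedy F t)) x∉G))

      greedyCompletion : ∃[ L ] CompleteList X G (final B (Greedy.rounds (suc n))) L
      greedyCompletion = completion n _ (m≤m+n n _)

      greedyList : List (Fin n × Fin n)
      greedyList = Greedy.rounds (suc n) ++ proj₁ greedyCompletion

      greedyForces : ForceSet n
      greedyForces b w = does ((b , w) ∈ₗ? greedyList)

      greedyForces-isForceSet : IsForceSet X G B greedyForces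
      greedyForces-isForceSet =
        greedyList ,
        complete-++ (Greedy.rounds (suc n)) _ (rounds-chronological B _ (suc n)) (proj₂ greedyCompletion) ,
        λ b w → listed b w , dec-true ((b , w) ∈ₗ? greedyList)
        where listed : ∀ b w → greedyForces b w ≡ true → (b , w) ∈ₗ greedyList
              listed b w e  with (b , w) ∈ₗ? greedyList
              listed b w e  | yes m = m
              listed b w () | no _

      module Fastest = Steps B greedyForces

      newly-agree : ∀ t → Fastest.newly (Greedy.cum t) ≡ Greedy.newly (Greedy.cum t)
      newly-agree t = ⊆-antisym fastest⊆greedy greedy⊆fastest
        where
          fastest⊆greedy : Fastest.newly (Greedy.cum t) ⊆ Greedy.newly (Greedy.cum t)
          fastest⊆greedy w∈ with Fastest.∈-newly⁻ {Greedy.cum t} w∈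
          ... | b , b∈ , _ , v = Greedy.∈-newly⁺ b∈ refl v

          greedy⊆fastest : Greedy.newly (Greedy.cum t) ⊆ Fastest.newly (Greedy.cum t)
          greedy⊆fastest {w} w∈ with t ≤? n | Greedy.newly-forced-in-step-round {Greedy.cum t} w∈
          ... | no t≰n  | _         = ⊥-elim (Greedy.idle-after t (≰⇒> t≰n) (w , w∈))
          ... | yes t≤n | b , m , a with Greedy.active⁻ {Greedy.cum t} a
          ...   | b∈ , _ , v = Fastest.∈-newly⁺ b∈ (dec-true ((b , w) ∈ₗ? greedyList) in-list) v
            where in-list = ∈-++⁺ˡ (Greedy.step-round⊆rounds (s≤s t≤n) m)

      greedyForces-cum : ∀ t → Fastest.cum t ≡ Greedy.cum t
      greedyForces-cum zero    = refl
      greedyForces-cum (suc t) =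
        trans (cong (λ S → S ∪ Fastest.newly S) (greedyForces-cum t))
              (cong (Greedy.cum t ∪_) (newly-agree t))

      greedyForces-uniformlyFast : UniformlyFast X G B greedyForces
      greedyForces-uniformlyFast v v∉B F _ zero    j v∈B _   = ⊥-elim (v∉B v∈B)
      greedyForces-uniformlyFast v v∉B F _ (suc i) j v∈  v∈F with suc i ≤? j
      ... | yes i<j = i<j
      ... | no  i≮j = ⊥-elim (Fastest.newly-white v∈ (subst (v ∈_) (sym (greedyForces-cum i)) v∈greedy))
        where v∈greedy : v ∈ Greedy.cum i
              v∈greedy = Greedy.cum-mono (≤-pred (≰⇒> i≮j)) (cum⊆greedy F j (Steps.step⊆cum B F j v∈F))

lemma3p5 : (X : Rule) → Simple X → NearlyWellBehaved X →
    ∀ {n : ℕ} (G : Graph n) (B : Subset n) → IsForcingSet X G B →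
    ∃[ F* ] (IsForceSet X G B F* × UniformlyFast X G B F*)
lemma3p5 X simple _ G B _ = greedyForces , greedyForces-isForceSet , greedyForces-uniformlyFast
  where open Forcing.GreedyForces X G simple B
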